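{- Let $\Delta$ be a fundamental discriminant, $K=\mathbb{Q}(\sqrt{\Delta})$, $\mathcal{O}$ its ring of integers, and let $n\ge 2$ be an integer. Consider the group $\mathcal{O}^*/\mathbb{N}^n$ described in the context. Let $\Pi_n$ be the set of classes $\alpha\mathbb{N}^n\in\mathcal{O}^*/\mathbb{N}^n$ which lie in the kernel of the norm homomorphism $N:\mathcal{O}^*/\mathbb{N}^n\to\mathbb{Z}^*/\mathbb{Z}^{*\,n}$ and which contain a primitive element $\alpha$ (i.e., $\alpha$ primitive and $N(\alpha)=A^n$ for some integer $A$). Then $\Pi_n$ is a subgroup of $\mathcal{O}^*/\mathbb{N}^n$.
   Context: $\mathcal{O}^*$ denotes the set of nonzero elements of $\mathcal{O}$ (a multiplicative monoid), $\mathbb{N}$ the positive integers and $\mathbb{N}^n=\{a^n: a\in\mathbb{N}\}$. On $\mathcal{O}^*$ define $\alpha\sim\beta$ iff $a^n\alpha=b^n\beta$ for some $a,b\in\mathbb{N}$; the class of $\alpha$ is written $\alpha\mathbb{N}^n$, and $\mathcal{O}^*/\mathbb{N}^n$ is the set of classes with multiplication $\alpha\mathbb{N}^n\cdot\beta\mathbb{N}^n=\alpha\beta\mathbb{N}^n$; it is a group with neutral element $1\mathbb{N}^n$, the inverse of $\alpha\mathbb{N}^n$ being $(|N(\alpha)|^n/\alpha)\mathbb{N}^n$. Similarly $\mathbb{Z}^*=\mathbb{Z}\setminus\{0\}$ and $\mathbb{Z}^*/\mathbb{Z}^{*\,n}$ is the group of classes of nonzero integers under $x\sim y$ iff $xu^n=yv^n$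 for nonzero integers $u,v$. The norm $N(\alpha)=\alpha\alpha'$ ($\alpha'$ the Galois conjugate) induces a homomorphism $N:\mathcal{O}^*/\mathbb{N}^n\to\mathbb{Z}^*/\mathbb{Z}^{*\,n}$; a class $\alpha\mathbb{N}^n$ lies in its kernel iff $N(\alpha)=A^n$ for some integer $A$. A nonzero $\alpha\in\mathcal{O}$ is called primitive if no rational prime $p\in\mathbb{N}$ divides $\alpha$ in $\mathcal{O}$. -}

module Defs where

open import Data.Nat as ℕ using (ℕ; suc)
import Data.Nat.Divisibility as ℕD
open import Data.Nat.Primality using (Prime)
open import Data.Integer using (ℤ; +_; _+_; _-_; _*_; -_; ∣_∣; _^_)
open import Data.Integer.DivMod using (_/_; _%_)
open import Data.Product using (Σ; _×_; _,_; ∃)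
open import Data.Sum using (_⊎_)
open import Relation.Binary.PropositionalEquality using (_≡_; _≢_)
open import Relation.Nullary using (¬_)

SquareFree : ℤ → Set
SquareFree D = ∀ (d : ℕ) → (d ℕ.* d) ℕD.∣ ∣ D ∣ → d ≡ 1

FundamentalDiscriminant : ℤ → Set
FundamentalDiscriminant Δ =
  Δ ≢ + 1 ×
  ( (Δ % + 4 ≡ 1 × SquareFree Δ)
  ⊎ Σ ℤ (λ m → Δ ≡ + 4 * m × (m % + 4 ≡ 2 ⊎ m % + 4 ≡ 3) × SquareFree m))

module QuadraticOrder (Δ : ℤ) where

  -- The ring of integers of ℚ(√Δ) is ℤ[ω] with ω = (Δ + √Δ)/2,
  -- ω² = Δ ω - (Δ² - Δ)/4 and conjugate ω' = Δ - ω.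
  -- An element x + y ω is represented by the pair (x , y).
  record 𝒪 : Set where
    constructor _+_ω
    field
      re : ℤ
      im : ℤ
  open 𝒪 public

  c₀ : ℤ
  c₀ = (Δ * Δ - Δ) / + 4

  infixl 7 _·_
  _·_ : 𝒪 → 𝒪 → 𝒪
  (a + b ω) · (c + d ω) = (a * c - b * d * c₀) + (a * d + b * c + b * d * Δ) ω

  ι : ℤ → 𝒪
  ι k = k + + 0 ω

  one : 𝒪
  one = ι (+ 1)

  conj : 𝒪 → 𝒪
  conj (x + y ω) = (x + y * Δ) + (- y) ω

  N : 𝒪 → ℤ
  N (x + y ω) = x * x + Δ * x * y + c₀ * y * y

  Nonzero : 𝒪 → Set
  Nonzero α = α ≢ ι (+ 0)

  _∣𝒪_ : 𝒪 → 𝒪 → Set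
  γ ∣𝒪 α = Σ 𝒪 (λ β → α ≡ γ · β)

  Primitive : 𝒪 → Set
  Primitive α = Nonzero α × (∀ (p : ℕ) → Prime p → ¬ (ι (+ p) ∣𝒪 α))

  module _ (n : ℕ) where

    _∼_ : 𝒪 → 𝒪 → Set
    α ∼ β = Σ ℕ λ a → Σ ℕ λ b →
      ι ((+ suc a) ^ n) · α ≡ ι ((+ suc b) ^ n) · β

    InΠ : 𝒪 → Set
    InΠ α = Σ 𝒪 λ β → β ∼ α × Primitive β × Σ ℤ (λ A → N β ≡ A ^ n)

    -- Π_n is a subgroup of 𝒪*/ℕⁿ (neutral element 1ℕⁿ, product αβℕⁿ,
    -- inverse (|N(α)|ⁿ/α)ℕⁿ, i.e. the class of the γ with γ α = |N(α)|ⁿ).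
    IsSubgroupΠ : Set
    IsSubgroupΠ =
      InΠ one
      × (∀ α β → Nonzero α → Nonzero β → InΠ α → InΠ β → InΠ (α · β))
      × (∀ α γ → Nonzero α → InΠ α → γ · α ≡ ι (+ (∣ N α ∣ ℕ.^ n)) → InΠ γ)

-- When Δ is a fundamental discriminant, no prime p divides the trace of a primitive α = x + yω
-- while p² divides its norm: Tr α² = Δ·y² + 4·N α would force p² ∣ Δ, which squarefreeness
-- excludes except for p = 2 and Δ = 4m; there N α = (x + 2my)² − m·y² with y odd, which is not
-- divisible by 4 as m ≡ 2, 3 (mod 4).
--
-- Now let α, β be primitive with N α = Aⁿ, N β = Bⁿ, and suppose p^(qn+1) divides αβ. Multiplying
-- by conj α shows that p^(qn+1) divides N α = Aⁿ, hence so does p^((q+1)n), and likewise for N β.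
-- As n ≥ 2, p² divides both norms, so p divides neither Tr α nor Tr β, and hence, because
-- Tr(αβ) + Tr(αβ′) = Tr α · Tr β, not Tr(αβ′) either. The identity Tr(αβ′)·αβ = N α·β² + N β·α²
-- then yields p^((q+1)n) ∣ αβ. So the content of αβ is an n-th power mⁿ, and αβ/mⁿ is a primitive
-- element of the class of αβ whose norm (AB/m²)ⁿ is an n-th power. For the inverse class, ±conj β
-- works, β being a primitive element of the class of α: it is an inverse of β up to |N β| = |B|ⁿ.

module Submission where

open import Defs
open import Data.Nat using (ℕ; _≥_)
open import Data.Integer using (ℤ)

open import Algebra.Bundles using (CommutativeSemigroup)
open import Data.Empty using (⊥-elim)
open import Data.Integer as ℤ
  using (+_; -[1+_]; _+_; _-_; _*_; -_; _^_; _/_; _%_) renaming (∣_∣ to abs)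
open import Data.Integer.DivMod using (n%d<d; a≡a%n+[a/n]*n)
open import Data.Integer.Divisibility.Signed
open import Data.Integer.Properties
open import Data.Integer.Tactic.RingSolver using (solve-∀)
open import Data.List using ([]; _∷_)
open import Data.List.Relation.Unary.All using (_∷_)
open import Data.Nat as ℕ using (zero; suc; s≤s; z≤n)
import Data.Nat.Divisibility as ℕD
open import Data.Nat.GCD using (gcd; gcd-greatest; gcd[m,n]∣m; gcd[m,n]∣n; gcd[m,n]≡0⇒m≡0; gcd[m,n]≡0⇒n≡0)
open import Data.Nat.Induction using (<-wellFounded)
open import Data.Nat.ListAction using (product)
open import Data.Nat.Primality
  using (Prime; euclidsLemma; prime⇒nonZero; prime⇒nonTrivial; prime⇒irreducible; prime[2]; ¬prime[1])
open import Data.Nat.Primality.Factorisation using (factorise)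
import Data.Nat.Properties as ℕP
open import Data.Product using (∃-syntax; _×_; _,_; proj₁; proj₂)
open import Data.Sum as Sum using (_⊎_; inj₁; inj₂; [_,_]′)
open import Function using (id)
open import Induction.WellFounded using (Acc; acc)
open import Relation.Binary.PropositionalEquality
open import Relation.Nullary using (¬_; yes; no)
open import Relation.Nullary.Decidable using (from-no)

private variable
  p : ℕ
  i j z : ℤ

euclidsLemmaℤ : ∀ i j → Prime p → + p ∣ i * j → + p ∣ i ⊎ + p ∣ j
euclidsLemmaℤ i j pr p∣ij = Sum.map ∣ᵤ⇒∣ ∣ᵤ⇒∣
  (euclidsLemma (abs i) (abs j) pr (subst (_ ℕD.∣_) (abs-* i j) (∣⇒∣ᵤ p∣ij)))

prime∣^⇒prime∣ : ∀ n .{{_ : ℕ.NonZero n}} → Prime p → + p ∣ i ^ n → + p ∣ i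
prime∣^⇒prime∣ {i = i} (suc zero)    pr p∣i^1 = subst (_ ∣_) (*-identityʳ i) p∣i^1
prime∣^⇒prime∣ {i = i} (suc (suc n)) pr p∣i^n =
  [ id , prime∣^⇒prime∣ (suc n) pr ]′ (euclidsLemmaℤ i (i ^ suc n) pr p∣i^n)

prime^∣i*j⇒prime^∣j : ∀ k → Prime p → ¬ (+ p ∣ i) → (+ p) ^ k ∣ i * j → (+ p) ^ k ∣ j
prime^∣i*j⇒prime^∣j {j = j} zero pr p∤i _ = divides j (sym (*-identityʳ j))
prime^∣i*j⇒prime^∣j {p} {i} {j} (suc k) pr p∤i p^k+1∣ij
  with euclidsLemmaℤ i j pr (∣-trans (∣m⇒∣m*n _ ∣-refl) p^k+1∣ij)
... | inj₁ p∣i = ⊥-elim (p∤i p∣i)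
... | inj₂ (divides j′ refl) =
  subst (_∣ j′ * + p) (*-comm ((+ p) ^ k) (+ p)) (*-monoˡ-∣ (+ p) p^k∣j′)
  where
  p^k∣j′ : (+ p) ^ k ∣ j′
  p^k∣j′ = prime^∣i*j⇒prime^∣j k pr p∤i (*-cancelʳ-∣ (+ p) {{prime⇒nonZero pr}}
    (subst₂ _∣_ (*-comm (+ p) ((+ p) ^ k)) (sym (*-assoc i j′ (+ p))) p^k+1∣ij))

^-distrib-* : ∀ i j n → (i * j) ^ n ≡ i ^ n * j ^ n
^-distrib-* i j zero    = refl
^-distrib-* i j (suc n) = trans (cong (i * j *_) (^-distrib-* i j n)) (interchange i j (i ^ n) (j ^ n))
  where
  interchange : ∀ a b c d → a * b * (c * d) ≡ a * c * (b * d)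
  interchange = solve-∀

^-monoˡ-∣ : ∀ n → i ∣ j → i ^ n ∣ j ^ n
^-monoˡ-∣ {i} n (divides q refl) = divides (q ^ n) (^-distrib-* q i n)

^-monoʳ-∣ : ∀ i {m n} → m ℕ.≤ n → i ^ m ∣ i ^ n
^-monoʳ-∣ i {m} {n} m≤n = divides (i ^ (n ℕ.∸ m)) (begin
  i ^ n                   ≡⟨ cong (i ^_) (ℕP.m+[n∸m]≡n m≤n) ⟨
  i ^ (m ℕ.+ (n ℕ.∸ m))   ≡⟨ ^-distribˡ-+-* i m (n ℕ.∸ m) ⟩
  i ^ m * i ^ (n ℕ.∸ m)   ≡⟨ *-comm (i ^ m) _ ⟩
  i ^ (n ℕ.∸ m) * i ^ m   ∎)
  where open ≡-Reasoning

pos-^ : ∀ m n → + (m ℕ.^ n) ≡ (+ m) ^ n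
pos-^ m zero    = refl
pos-^ m (suc n) = trans (pos-* m (m ℕ.^ n)) (cong (+ m *_) (pos-^ m n))

abs-^ : ∀ i n → abs (i ^ n) ≡ abs i ℕ.^ n
abs-^ i zero    = refl
abs-^ i (suc n) = trans (abs-* i (i ^ n)) (cong (abs i ℕ.*_) (abs-^ i n))

pos^-nonZero : ∀ m .{{_ : ℕ.NonZero m}} n → ℤ.NonZero ((+ m) ^ n)
pos^-nonZero m n = subst ℤ.NonZero (pos-^ m n) (ℕP.m^n≢0 m n)

prime^-nonZero : Prime p → ∀ n → ℤ.NonZero ((+ p) ^ n)
prime^-nonZero {p} pr = pos^-nonZero p {{prime⇒nonZero pr}}

0^n≡0 : ∀ n .{{_ : ℕ.NonZero n}} → (+ 0) ^ n ≡ + 0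
0^n≡0 (suc n) = refl

prime^[1+qn]∣iⁿ⇒prime^[1+q]∣i : ∀ n .{{_ : ℕ.NonZero n}} q → Prime p →
                                (+ p) ^ suc (q ℕ.* n) ∣ i ^ n → (+ p) ^ suc q ∣ i
prime^[1+qn]∣iⁿ⇒prime^[1+q]∣i {p} {i} n zero pr p∣iⁿ =
  subst (_∣ i) (sym (*-identityʳ (+ p))) (prime∣^⇒prime∣ n pr (∣-trans (∣m⇒∣m*n (+ 1) ∣-refl) p∣iⁿ))
prime^[1+qn]∣iⁿ⇒prime^[1+q]∣i {p} {i} n (suc q) pr p^[1+qn]∣iⁿ
  with prime∣^⇒prime∣ n pr (∣-trans (∣m⇒∣m*n ((+ p) ^ (suc q ℕ.* n)) ∣-refl) p^[1+qn]∣iⁿ)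
... | divides i′ refl = subst (_∣ i′ * + p) (*-comm ((+ p) ^ suc q) (+ p)) (*-monoˡ-∣ (+ p) p^[1+q]∣i′)
  where
  exponent : (+ p) ^ suc (suc q ℕ.* n) ≡ (+ p) ^ suc (q ℕ.* n) * (+ p) ^ n
  exponent = trans (cong (λ e → (+ p) ^ suc e) (ℕP.+-comm n (q ℕ.* n)))
                   (^-distribˡ-+-* (+ p) (suc (q ℕ.* n)) n)
  p^[1+q]∣i′ : (+ p) ^ suc q ∣ i′
  p^[1+q]∣i′ = prime^[1+qn]∣iⁿ⇒prime^[1+q]∣i n q pr (*-cancelʳ-∣ ((+ p) ^ n) {{prime^-nonZero pr n}}
    (subst₂ _∣_ exponent (^-distrib-* i′ (+ p) n) p^[1+qn]∣iⁿ))

prime^[1+qn]∣iⁿ⇒prime^[[1+q]n]∣iⁿ : ∀ n .{{_ : ℕ.NonZero n}} q → Prime p →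
                                   (+ p) ^ suc (q ℕ.* n) ∣ i ^ n → (+ p) ^ (suc q ℕ.* n) ∣ i ^ n
prime^[1+qn]∣iⁿ⇒prime^[[1+q]n]∣iⁿ {p} {i} n q pr p^[1+qn]∣iⁿ = subst (_∣ i ^ n) (^-*-assoc (+ p) (suc q) n)
  (^-monoˡ-∣ n (prime^[1+qn]∣iⁿ⇒prime^[1+q]∣i n q pr p^[1+qn]∣iⁿ))

primeDivisor : ∀ {m} → 2 ℕ.≤ m → ∃[ p ] Prime p × p ℕD.∣ m
primeDivisor {m@(suc _)} 2≤m with factorise m
... | record { factors = [] ; isFactorisation = m≡1 } = ⊥-elim (ℕP.<⇒≢ 2≤m (sym m≡1))
... | record { factors = p ∷ ps ; isFactorisation = m≡p*ps ; factorsPrime = p-prime ∷ _ } =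
  p , p-prime , subst (p ℕD.∣_) (sym m≡p*ps) (ℕD.m∣m*n (product ps))

prime≢1 : Prime p → p ≢ 1
prime≢1 pr refl = ¬prime[1] pr

i^2≡i*i : ∀ i → i ^ 2 ≡ i * i
i^2≡i*i i = cong (i *_) (*-identityʳ i)

i*i≡+∣i∣*∣i∣ : ∀ i → i * i ≡ + (abs i ℕ.* abs i)
i*i≡+∣i∣*∣i∣ (+ n)    = sym (pos-* n n)
i*i≡+∣i∣*∣i∣ -[1+ n ] = refl

i*[j*j]≡1⇒i≡1 : ∀ i j → i * (j * j) ≡ + 1 → i ≡ + 1
i*[j*j]≡1⇒i≡1 i j ij²≡1 = begin
  i                             ≡⟨ *-identityʳ i ⟨
  i * + 1                       ≡⟨ cong (λ n → i * + n) ∣j∣²≡1 ⟨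
  i * + (abs j ℕ.* abs j)       ≡⟨ cong (i *_) (i*i≡+∣i∣*∣i∣ j) ⟨
  i * (j * j)                   ≡⟨ ij²≡1 ⟩
  + 1                           ∎
  where
  open ≡-Reasoning
  ∣j∣²≡1 : abs j ℕ.* abs j ≡ 1
  ∣j∣²≡1 = ℕP.m*n≡1⇒n≡1 (abs i) _
    (trans (sym (abs-* i (+ (abs j ℕ.* abs j)))) (cong abs (trans (cong (i *_) (sym (i*i≡+∣i∣*∣i∣ j))) ij²≡1)))

noPrimeDivisor⇒∣i∣≡1 : (∀ {p} → Prime p → ¬ (+ p ∣ i)) → abs i ≡ 1
noPrimeDivisor⇒∣i∣≡1 {i} no-p∣ with abs i in ∣i∣≡
... | 0           = ⊥-elim (no-p∣ prime[2] (subst (+ 2 ∣_) (sym (∣i∣≡0⇒i≡0 ∣i∣≡)) (divides (+ 0) refl)))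
... | 1           = refl
... | suc (suc k) with primeDivisor {suc (suc k)} (s≤s (s≤s z≤n))
...   | p , pr , p∣∣i∣ = ⊥-elim (no-p∣ pr (∣ᵤ⇒∣ (subst (p ℕD.∣_) (sym ∣i∣≡) p∣∣i∣)))

∣⇒≡[/]* : ∀ d .{{_ : ℕ.NonZero d}} → + d ∣ i → i ≡ (i / + d) * + d
∣⇒≡[/]* {i} d d∣i with i % + d | n%d<d i (+ d) | a≡a%n+[a/n]*n i (+ d)
... | zero  | _   | i≡q*d = trans i≡q*d (+-identityˡ _)
... | suc r | r<d | i≡r+q*d = ⊥-elim (ℕP.<⇒≱ r<d (ℕD.∣⇒≤ (∣⇒∣ᵤ d∣r)))
  where
  d∣r : + d ∣ + suc r
  d∣r = ∣m+n∣n⇒∣m (subst (+ d ∣_) i≡r+q*d d∣i) (∣n⇒∣m*n (i / + d) ∣-refl)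

squareFree⇒prime²∤ : SquareFree z → Prime p → ¬ ((+ p) ^ 2 ∣ z)
squareFree⇒prime²∤ {z} {p} z-squareFree pr p²∣z = prime≢1 pr (z-squareFree p
  (subst (ℕD._∣ abs z) (trans (abs-^ (+ p) 2) (cong (p ℕ.*_) (ℕP.*-identityʳ p))) (∣⇒∣ᵤ p²∣z)))

prime≢2⇒prime∤4 : Prime p → p ≢ 2 → ¬ (+ p ∣ + 4)
prime≢2⇒prime∤4 {p} pr p≢2 p∣4 = [ p∤2 , p∤2 ]′ (euclidsLemmaℤ (+ 2) (+ 2) pr p∣4)
  where
  p∤2 : ¬ (+ p ∣ + 2)
  p∤2 p∣2 = [ prime≢1 pr , p≢2 ]′ (prime⇒irreducible prime[2] (∣⇒∣ᵤ p∣2))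

4∤[e+2w]²-[r+4t][1+2s]² : ∀ {e r} w s t → e ℕ.< 2 → r ≡ 2 ⊎ r ≡ 3 →
  ¬ (+ 4 ∣ (+ e + w * + 2) * (+ e + w * + 2) - (+ r + t * + 4) * ((+ 1 + s * + 2) * (+ 1 + s * + 2)))
4∤[e+2w]²-[r+4t][1+2s]² {e} {r} w s t e<2 r≡2∨3 4∣ =
  residue e<2 r≡2∨3 (∣m+n∣n⇒∣m (subst (+ 4 ∣_) (identity (+ e) w s (+ r) t) 4∣) (divides q refl))
  where
  identity : ∀ e w s r t →
    (e + w * + 2) * (e + w * + 2) - (r + t * + 4) * ((+ 1 + s * + 2) * (+ 1 + s * + 2))
      ≡ e * e - r + (e * w + w * w - t * ((+ 1 + s * + 2) * (+ 1 + s * + 2)) - r * (s + s * s)) * + 4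
  identity = solve-∀
  q : ℤ
  q = + e * w + w * w - t * ((+ 1 + s * + 2) * (+ 1 + s * + 2)) - + r * (s + s * s)
  residue : ∀ {e r} → e ℕ.< 2 → r ≡ 2 ⊎ r ≡ 3 → ¬ (+ 4 ∣ + e * + e - + r)
  residue {0}         _ (inj₁ refl) = from-no (+ 4 ∣? - + 2)
  residue {0}         _ (inj₂ refl) = from-no (+ 4 ∣? - + 3)
  residue {1}         _ (inj₁ refl) = from-no (+ 4 ∣? - + 1)
  residue {1}         _ (inj₂ refl) = from-no (+ 4 ∣? - + 2)
  residue {suc (suc _)} (s≤s (s≤s ()))

4∤x²-my² : ∀ {m x y} → m % + 4 ≡ 2 ⊎ m % + 4 ≡ 3 → ¬ (+ 2 ∣ y) → ¬ (+ 4 ∣ x * x - m * (y * y))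
4∤x²-my² {m} {x} {y} m%4≡2∨3 2∤y 4∣x²-my² with y % + 2 | n%d<d y (+ 2) | a≡a%n+[a/n]*n y (+ 2)
... | 0 | _ | y≡2s = 2∤y (divides (y / + 2) (trans y≡2s (+-identityˡ _)))
... | 1 | _ | y≡1+2s = 4∤[e+2w]²-[r+4t][1+2s]² (x / + 2) (y / + 2) (m / + 4) (n%d<d x (+ 2)) m%4≡2∨3
  (subst (+ 4 ∣_) (trans (cong (λ x → x * x - m * (y * y)) x≡e+2w)
                         (cong₂ (λ m y → x′ * x′ - m * (y * y)) m≡r+4t y≡1+2s)) 4∣x²-my²)
  where
  x′ : ℤ
  x′ = + (x % + 2) + (x / + 2) * + 2
  x≡e+2w : x ≡ x′
  x≡e+2w = a≡a%n+[a/n]*n x (+ 2)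
  m≡r+4t : m ≡ + (m % + 4) + (m / + 4) * + 4
  m≡r+4t = a≡a%n+[a/n]*n m (+ 4)
... | suc (suc _) | s≤s (s≤s ()) | _

4∣Δ²-Δ : ∀ {Δ} → FundamentalDiscriminant Δ → + 4 ∣ Δ * Δ - Δ
4∣Δ²-Δ {Δ} (_ , inj₁ (Δ%4≡1 , _)) =
  divides (t + t * t * + 4) (trans (cong (λ Δ → Δ * Δ - Δ) Δ≡1+4t) (identity t))
  where
  t : ℤ
  t = Δ / + 4
  Δ≡1+4t : Δ ≡ + 1 + t * + 4
  Δ≡1+4t = subst (λ r → Δ ≡ + r + t * + 4) Δ%4≡1 (a≡a%n+[a/n]*n Δ (+ 4))
  identity : ∀ t → (+ 1 + t * + 4) * (+ 1 + t * + 4) - (+ 1 + t * + 4) ≡ (t + t * t * + 4) * + 4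
  identity = solve-∀
4∣Δ²-Δ (_ , inj₂ (m , Δ≡4m , _)) =
  divides (+ 4 * m * m - m) (trans (cong (λ Δ → Δ * Δ - Δ) Δ≡4m) (identity m))
  where
  identity : ∀ m → (+ 4 * m) * (+ 4 * m) - (+ 4 * m) ≡ (+ 4 * m * m - m) * + 4
  identity = solve-∀

module _ (Δ : ℤ) where
  open QuadraticOrder Δ

  private variable
    α β γ δ ε : 𝒪
    A B D c k : ℤ

  Tr : 𝒪 → ℤ
  Tr (x + y ω) = + 2 * x + Δ * y

  ·-comm : ∀ α β → α · β ≡ β · α
  ·-comm (x + y ω) (u + v ω) = cong₂ _+_ω (re-comm x y u v Δ c₀) (im-comm x y u v Δ c₀)
    where
    re-comm : ∀ x y u v D c → x * u - y * v * c ≡ u * x - v * y * c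
    re-comm = solve-∀
    im-comm : ∀ x y u v D c → x * v + y * u + y * v * D ≡ u * y + v * x + v * y * D
    im-comm = solve-∀

  ·-assoc : ∀ α β γ → (α · β) · γ ≡ α · (β · γ)
  ·-assoc (x + y ω) (u + v ω) (s + t ω) = cong₂ _+_ω (re-assoc x y u v s t Δ c₀) (im-assoc x y u v s t Δ c₀)
    where
    re-assoc : ∀ x y u v s t D c →
      (x * u - y * v * c) * s - (x * v + y * u + y * v * D) * t * c
        ≡ x * (u * s - v * t * c) - y * (u * t + v * s + v * t * D) * c
    re-assoc = solve-∀
    im-assoc : ∀ x y u v s t D c →
      (x * u - y * v * c) * t + (x * v + y * u + y * v * D) * s + (x * v + y * u + y * v * D) * t * D
        ≡ x * (u * t + v * s + v * t * D) + y * (u * s - v * t * c) + y * (u * t + v * s + v * t * D) * D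
    im-assoc = solve-∀

  ·-commutativeSemigroup : CommutativeSemigroup _ _
  ·-commutativeSemigroup = record
    { Carrier = 𝒪
    ; _≈_ = _≡_
    ; _∙_ = _·_
    ; isCommutativeSemigroup = record
      { isSemigroup = record
        { isMagma = record { isEquivalence = isEquivalence ; ∙-cong = cong₂ _·_ }
        ; assoc = ·-assoc
        }
      ; comm = ·-comm
      }
    }

  open import Algebra.Properties.CommutativeSemigroup ·-commutativeSemigroup
    using (x∙yz≈y∙xz; x∙yz≈yx∙z; x∙yz≈zx∙y)

  ι·-scales : ∀ k α → ι k · α ≡ (k * re α) + (k * im α) ω
  ι·-scales k (x + y ω) = cong₂ _+_ω (re-scale k x y Δ c₀) (im-scale k x y Δ c₀)
    where
    re-scale : ∀ k x y D c → k * x - + 0 * y * c ≡ k * x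
    re-scale = solve-∀
    im-scale : ∀ k x y D c → k * y + + 0 * x + + 0 * y * D ≡ k * y
    im-scale = solve-∀

  ι-* : ∀ k l α → ι k · (ι l · α) ≡ ι (k * l) · α
  ι-* k l α = begin
    ι k · (ι l · α)                        ≡⟨ cong (ι k ·_) (ι·-scales l α) ⟩
    ι k · ((l * re α) + (l * im α) ω)      ≡⟨ ι·-scales k _ ⟩
    (k * (l * re α)) + (k * (l * im α)) ω  ≡⟨ cong₂ _+_ω (*-assoc k l (re α)) (*-assoc k l (im α)) ⟨
    (k * l * re α) + (k * l * im α) ω      ≡⟨ ι·-scales (k * l) α ⟨
    ι (k * l) · α                          ∎
    where open ≡-Reasoning

  ι·ι : ∀ k l → ι k · ι l ≡ ι (k * l)
  ι·ι k l = trans (ι·-scales k (ι l)) (cong ((k * l) +_ω) (*-zeroʳ k))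

  ι1· : ∀ α → ι (+ 1) · α ≡ α
  ι1· α = trans (ι·-scales (+ 1) α) (cong₂ _+_ω (*-identityˡ (re α)) (*-identityˡ (im α)))

  ·-conj : ∀ α → α · conj α ≡ ι (N α)
  ·-conj (x + y ω) = cong₂ _+_ω (re-norm x y Δ c₀) (im-norm x y Δ c₀)
    where
    re-norm : ∀ x y D c → x * (x + y * D) - y * - y * c ≡ x * x + D * x * y + c * y * y
    re-norm = solve-∀
    im-norm : ∀ x y D c → x * - y + y * (x + y * D) + y * - y * D ≡ + 0
    im-norm = solve-∀

  N-· : ∀ α β → N (α · β) ≡ N α * N β
  N-· (x + y ω) (u + v ω) = norm-multiplicative x y u v Δ c₀
    where
    norm-multiplicative : ∀ x y u v D c →
      (x * u - y * v * c) * (x * u - y * v * c) + D * (x * u - y * v * c) * (x * v + y * u + y * v * D)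
        + c * (x * v + y * u + y * v * D) * (x * v + y * u + y * v * D)
        ≡ (x * x + D * x * y + c * y * y) * (u * u + D * u * v + c * v * v)
    norm-multiplicative = solve-∀

  N-conj : ∀ α → N (conj α) ≡ N α
  N-conj (x + y ω) = norm-conj x y Δ c₀
    where
    norm-conj : ∀ x y D c → (x + y * D) * (x + y * D) + D * (x + y * D) * - y + c * - y * - y
                              ≡ x * x + D * x * y + c * y * y
    norm-conj = solve-∀

  N-ι : ∀ k → N (ι k) ≡ k * k
  N-ι k = norm-ι k Δ c₀
    where
    norm-ι : ∀ k D c → k * k + D * k * + 0 + c * + 0 * + 0 ≡ k * k
    norm-ι = solve-∀

  Tr-·-conj : ∀ α β → Tr (α · β) + Tr (α · conj β) ≡ Tr α * Tr β
  Tr-·-conj (x + y ω) (u + v ω) = trace-identity x y u v Δ c₀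
    where
    trace-identity : ∀ x y u v D c →
      + 2 * (x * u - y * v * c) + D * (x * v + y * u + y * v * D)
        + (+ 2 * (x * (u + v * D) - y * - v * c) + D * (x * - v + y * (u + v * D) + y * - v * D))
        ≡ (+ 2 * x + D * y) * (+ 2 * u + D * v)
    trace-identity = solve-∀

  Tr-·-conj*re-· : ∀ α β → Tr (α · conj β) * re (α · β) ≡ N α * re (β · β) + N β * re (α · α)
  Tr-·-conj*re-· (x + y ω) (u + v ω) = identity x y u v Δ c₀
    where
    identity : ∀ x y u v D c →
      (+ 2 * (x * (u + v * D) - y * - v * c) + D * (x * - v + y * (u + v * D) + y * - v * D))
        * (x * u - y * v * c)
        ≡ (x * x + D * x * y + c * y * y) * (u * u - v * v * c)
          + (u * u + D * u * v + c * v * v) * (x * x - y * y * c)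
    identity = solve-∀

  Tr-·-conj*im-· : ∀ α β → Tr (α · conj β) * im (α · β) ≡ N α * im (β · β) + N β * im (α · α)
  Tr-·-conj*im-· (x + y ω) (u + v ω) = identity x y u v Δ c₀
    where
    identity : ∀ x y u v D c →
      (+ 2 * (x * (u + v * D) - y * - v * c) + D * (x * - v + y * (u + v * D) + y * - v * D))
        * (x * v + y * u + y * v * D)
        ≡ (x * x + D * x * y + c * y * y) * (u * v + v * u + v * v * D)
          + (u * u + D * u * v + c * v * v) * (x * y + y * x + y * y * D)
    identity = solve-∀

  Tr*Tr : Δ * Δ - Δ ≡ + 4 * c₀ → ∀ α → Tr α * Tr α ≡ Δ * (im α * im α) + + 4 * N α
  Tr*Tr Δ²-Δ≡4c₀ (x + y ω) = begin
    (+ 2 * x + Δ * y) * (+ 2 * x + Δ * y)     ≡⟨ identity x y Δ c₀ ⟩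
    rhs + (Δ * Δ - Δ - + 4 * c₀) * (y * y)    ≡⟨ cong (λ z → rhs + z * (y * y)) (i≡j⇒i-j≡0 Δ²-Δ≡4c₀) ⟩
    rhs + + 0 * (y * y)                       ≡⟨ +-identityʳ rhs ⟩
    rhs                                       ∎
    where
    open ≡-Reasoning
    rhs : ℤ
    rhs = Δ * (y * y) + + 4 * N (x + y ω)
    identity : ∀ x y D c → (+ 2 * x + D * y) * (+ 2 * x + D * y)
      ≡ D * (y * y) + + 4 * (x * x + D * x * y + c * y * y) + (D * D - D - + 4 * c) * (y * y)
    identity = solve-∀

  infix 4 _∣ℤ_
  _∣ℤ_ : ℤ → 𝒪 → Set
  k ∣ℤ δ = k ∣ re δ × k ∣ im δ

  ∣ℤ-·ʳ : ∀ α → k ∣ℤ β → k ∣ℤ α · β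
  ∣ℤ-·ʳ {β = u + v ω} (x + y ω) (k∣u , k∣v) =
    ∣m∣n⇒∣m-n (∣n⇒∣m*n x k∣u) (∣m⇒∣m*n c₀ (∣n⇒∣m*n y k∣v)) ,
    ∣m∣n⇒∣m+n (∣m∣n⇒∣m+n (∣n⇒∣m*n x k∣v) (∣n⇒∣m*n y k∣u)) (∣m⇒∣m*n Δ (∣n⇒∣m*n y k∣v))

  ∣ℤ-ι· : ∀ {l} α → k ∣ l → k ∣ℤ ι l · α
  ∣ℤ-ι· {l = l} α k∣l = subst (_ ∣ℤ_) (sym (ι·-scales l α)) (∣m⇒∣m*n (re α) k∣l , ∣m⇒∣m*n (im α) k∣l)

  ∣-∣ℤ-trans : c ∣ k → k ∣ℤ δ → c ∣ℤ δ
  ∣-∣ℤ-trans c∣k (k∣x , k∣y) = ∣-trans c∣k k∣x , ∣-trans c∣k k∣y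

  *-monoˡ-∣ℤ : ∀ k δ → c ∣ℤ δ → k * c ∣ℤ ι k · δ
  *-monoˡ-∣ℤ k δ (c∣x , c∣y) = subst (_ ∣ℤ_) (sym (ι·-scales k δ)) (*-monoʳ-∣ k c∣x , *-monoʳ-∣ k c∣y)

  *-cancelˡ-∣ℤ : ∀ k δ .{{_ : ℤ.NonZero k}} → k * c ∣ℤ ι k · δ → c ∣ℤ δ
  *-cancelˡ-∣ℤ k δ kc∣kδ with subst (_ ∣ℤ_) (ι·-scales k δ) kc∣kδ
  ... | kc∣kx , kc∣ky = *-cancelˡ-∣ k kc∣kx , *-cancelˡ-∣ k kc∣ky

  ∣ℤ⇒ι∣𝒪 : k ∣ℤ δ → ι k ∣𝒪 δ
  ∣ℤ⇒ι∣𝒪 {k} {δ} (divides x′ x≡x′k , divides y′ y≡y′k) =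
    x′ + y′ ω ,
    trans (cong₂ _+_ω (trans x≡x′k (*-comm x′ k)) (trans y≡y′k (*-comm y′ k))) (sym (ι·-scales k (x′ + y′ ω)))

  ι∣𝒪⇒∣ℤ : ι k ∣𝒪 δ → k ∣ℤ δ
  ι∣𝒪⇒∣ℤ (δ′ , refl) = ∣ℤ-ι· δ′ ∣-refl

  ∣ℤ⇒∣Tr : k ∣ℤ δ → k ∣ Tr δ
  ∣ℤ⇒∣Tr (k∣x , k∣y) = ∣m∣n⇒∣m+n (∣n⇒∣m*n (+ 2) k∣x) (∣n⇒∣m*n Δ k∣y)

  CoprimeCoordinates : 𝒪 → Set
  CoprimeCoordinates α = ∀ {p} → Prime p → ¬ (+ p ∣ℤ α)

  primitive⇒coprimeCoordinates : Primitive α → CoprimeCoordinates α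
  primitive⇒coprimeCoordinates (_ , no-prime-divides) {p} pr p∣α = no-prime-divides p pr (∣ℤ⇒ι∣𝒪 p∣α)

  conj-·-· : ∀ α β → conj α · (α · β) ≡ ι (N α) · β
  conj-·-· α β = trans (x∙yz≈yx∙z (conj α) α β) (cong (_· β) (·-conj α))

  prime^∣ℤι·⇒prime^∣ : ∀ {p} k → CoprimeCoordinates β → Prime p → (+ p) ^ k ∣ℤ ι c · β → (+ p) ^ k ∣ c
  prime^∣ℤι·⇒prime^∣ {β} {c} {p} k β-coprime pr p^k∣cβ = from-coordinates (subst (_ ∣ℤ_) (ι·-scales c β) p^k∣cβ)
    where
    from-coordinates : (+ p) ^ k ∣ c * re β × (+ p) ^ k ∣ c * im β → (+ p) ^ k ∣ c
    from-coordinates (p^k∣cx , p^k∣cy) with + p ∣? re β | + p ∣? im β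
    ... | no p∤x  | _       = prime^∣i*j⇒prime^∣j k pr p∤x (subst (_ ∣_) (*-comm c (re β)) p^k∣cx)
    ... | yes _   | no p∤y  = prime^∣i*j⇒prime^∣j k pr p∤y (subst (_ ∣_) (*-comm c (im β)) p^k∣cy)
    ... | yes p∣x | yes p∣y = ⊥-elim (β-coprime pr (p∣x , p∣y))

  prime^∣ℤ·⇒prime^∣N : ∀ {p} k α → CoprimeCoordinates β → Prime p → (+ p) ^ k ∣ℤ α · β → (+ p) ^ k ∣ N α
  prime^∣ℤ·⇒prime^∣N {β} k α β-coprime pr p^[1+qn]∣αβ =
    prime^∣ℤι·⇒prime^∣ k β-coprime pr (subst (_ ∣ℤ_) (conj-·-· α β) (∣ℤ-·ʳ (conj α) p^[1+qn]∣αβ))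

  prime∣N⇒prime∤im : CoprimeCoordinates α → ∀ {p} → Prime p → + p ∣ N α → ¬ (+ p ∣ im α)
  prime∣N⇒prime∤im {x + y ω} α-coprime {p} pr p∣N p∣y = α-coprime pr (p∣x , p∣y)
    where
    p∣x*x : + p ∣ x * x
    p∣x*x = ∣m+n∣n⇒∣m (∣m+n∣n⇒∣m p∣N (∣n⇒∣m*n (c₀ * y) p∣y)) (∣n⇒∣m*n (Δ * x) p∣y)
    p∣x : + p ∣ x
    p∣x = [ id , id ]′ (euclidsLemmaℤ x x pr p∣x*x)

  N-ι· : ∀ k α → N (ι k · α) ≡ k * k * N α
  N-ι· k α = trans (N-· (ι k) α) (cong (_* N α) (N-ι k))

  N≢0⇒nonzero : N α ≢ + 0 → Nonzero α
  N≢0⇒nonzero {α} N≢0 α≡0 = N≢0 (trans (cong N α≡0) (N-ι (+ 0)))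

  prime^∣ℤι·⇒prime^∣ℤ : ∀ {p} k → Prime p → ¬ (+ p ∣ c) → (+ p) ^ k ∣ℤ ι c · δ → (+ p) ^ k ∣ℤ δ
  prime^∣ℤι·⇒prime^∣ℤ {c} {δ} k pr p∤c p^k∣cδ with subst (_ ∣ℤ_) (ι·-scales c δ) p^k∣cδ
  ... | p^k∣cx , p^k∣cy = prime^∣i*j⇒prime^∣j k pr p∤c p^k∣cx , prime^∣i*j⇒prime^∣j k pr p∤c p^k∣cy

  coprimeCoordinates-conj : CoprimeCoordinates α → CoprimeCoordinates (conj α)
  coprimeCoordinates-conj {x + y ω} α-coprime pr (p∣x+yΔ , p∣-y) =
    α-coprime pr (∣m+n∣n⇒∣m p∣x+yΔ (∣m⇒∣m*n Δ p∣y) , p∣y)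
    where
    p∣y : + _ ∣ y
    p∣y = subst (_ ∣_) (neg-involutive y) (∣m⇒∣-m p∣-y)

  coprimeCoordinates-neg : CoprimeCoordinates α → CoprimeCoordinates (ι (- + 1) · α)
  coprimeCoordinates-neg {α} α-coprime pr p∣-α =
    α-coprime pr (subst (_ ∣ℤ_) (trans (ι-* (- + 1) (- + 1) α) (ι1· α)) (∣ℤ-·ʳ (ι (- + 1)) p∣-α))

  primitive⊎prime∣ℤ : Nonzero δ → Primitive δ ⊎ ∃[ p ] Prime p × + p ∣ℤ δ
  primitive⊎prime∣ℤ {δ} δ≢0 with gcd (abs (re δ)) (abs (im δ)) in g≡
  ... | 0 = ⊥-elim (δ≢0 (cong₂ _+_ω (∣i∣≡0⇒i≡0 (gcd[m,n]≡0⇒m≡0 g≡)) (∣i∣≡0⇒i≡0 (gcd[m,n]≡0⇒n≡0 (abs (re δ)) g≡))))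
  ... | 1 = inj₁ (δ≢0 , λ p pr p∣δ → prime≢1 pr (ℕD.∣1⇒≡1 (subst (p ℕD.∣_) g≡
              (gcd-greatest (∣⇒∣ᵤ (proj₁ (ι∣𝒪⇒∣ℤ {k = + p} p∣δ))) (∣⇒∣ᵤ (proj₂ (ι∣𝒪⇒∣ℤ {k = + p} p∣δ)))))))
  ... | suc (suc g) with primeDivisor {suc (suc g)} (s≤s (s≤s z≤n))
  ...   | p , pr , p∣g = inj₂ (p , pr ,
            ∣ᵤ⇒∣ (ℕD.∣-trans p∣g (subst (ℕD._∣ abs (re δ)) g≡ (gcd[m,n]∣m (abs (re δ)) (abs (im δ))))) ,
            ∣ᵤ⇒∣ (ℕD.∣-trans p∣g (subst (ℕD._∣ abs (im δ)) g≡ (gcd[m,n]∣n (abs (re δ)) (abs (im δ))))))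

  size : 𝒪 → ℕ
  size δ = abs (re δ) ℕ.+ abs (im δ)

  size-ι· : ∀ k δ → size (ι k · δ) ≡ abs k ℕ.* size δ
  size-ι· k δ = trans (cong size (ι·-scales k δ))
    (trans (cong₂ ℕ._+_ (abs-* k (re δ)) (abs-* k (im δ))) (sym (ℕP.*-distribˡ-+ (abs k) _ _)))

  size≡0⇒≡0 : size δ ≡ 0 → δ ≡ ι (+ 0)
  size≡0⇒≡0 {δ} size≡0 = cong₂ _+_ω (∣i∣≡0⇒i≡0 (ℕP.m+n≡0⇒m≡0 _ size≡0)) (∣i∣≡0⇒i≡0 (ℕP.m+n≡0⇒n≡0 _ size≡0))

  Δ²-Δ≡4c₀ : FundamentalDiscriminant Δ → Δ * Δ - Δ ≡ + 4 * c₀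
  Δ²-Δ≡4c₀ fd = trans (∣⇒≡[/]* 4 (4∣Δ²-Δ fd)) (*-comm _ (+ 4))

  N≡[x+2my]²-my² : Δ * Δ - Δ ≡ + 4 * c₀ → ∀ {m} → Δ ≡ + 4 * m →
                   ∀ x y → N (x + y ω) ≡ (x + + 2 * m * y) * (x + + 2 * m * y) - m * (y * y)
  N≡[x+2my]²-my² Δ²-Δ≡4c₀ {m} Δ≡4m x y =
    trans (cong₂ (λ D c → x * x + D * x * y + c * y * y) Δ≡4m c₀≡4m²-m) (identity x y m)
    where
    c₀≡4m²-m : c₀ ≡ + 4 * m * m - m
    c₀≡4m²-m = *-cancelˡ-≡ (+ 4) c₀ (+ 4 * m * m - m)
      (trans (sym Δ²-Δ≡4c₀) (trans (cong (λ Δ → Δ * Δ - Δ) Δ≡4m) (scale m)))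
      where
      scale : ∀ m → (+ 4 * m) * (+ 4 * m) - (+ 4 * m) ≡ + 4 * (+ 4 * m * m - m)
      scale = solve-∀
    identity : ∀ x y m → x * x + + 4 * m * x * y + (+ 4 * m * m - m) * y * y
                           ≡ (x + + 2 * m * y) * (x + + 2 * m * y) - m * (y * y)
    identity = solve-∀

  prime∣Tr∧prime²∣N⇒prime²∣Δ : Δ * Δ - Δ ≡ + 4 * c₀ → CoprimeCoordinates α → Prime p →
                               + p ∣ Tr α → (+ p) ^ 2 ∣ N α → (+ p) ^ 2 ∣ Δ
  prime∣Tr∧prime²∣N⇒prime²∣Δ {α} {p} Δ²-Δ≡4c₀ α-coprime pr p∣Tr p²∣N =
    prime^∣i*j⇒prime^∣j 2 pr p∤y² (subst (_ ∣_) (*-comm Δ (y * y)) p²∣Δy²)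
    where
    y : ℤ
    y = im α
    p∤y : ¬ (+ p ∣ y)
    p∤y = prime∣N⇒prime∤im α-coprime pr (∣-trans (∣m⇒∣m*n ((+ p) ^ 1) ∣-refl) p²∣N)
    p∤y² : ¬ (+ p ∣ y * y)
    p∤y² p∣y² = [ p∤y , p∤y ]′ (euclidsLemmaℤ y y pr p∣y²)
    p²∣Tr² : (+ p) ^ 2 ∣ Tr α * Tr α
    p²∣Tr² = subst (_ ∣_) (i^2≡i*i (Tr α)) (^-monoˡ-∣ 2 p∣Tr)
    p²∣Δy² : (+ p) ^ 2 ∣ Δ * (y * y)
    p²∣Δy² = ∣m+n∣n⇒∣m (subst (_ ∣_) (Tr*Tr Δ²-Δ≡4c₀ α) p²∣Tr²) (∣n⇒∣m*n (+ 4) p²∣N)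

  prime∣Tr⇒prime²∤N : FundamentalDiscriminant Δ → CoprimeCoordinates α → Prime p → + p ∣ Tr α → ¬ ((+ p) ^ 2 ∣ N α)
  prime∣Tr⇒prime²∤N fd@(_ , inj₁ (_ , Δ-squareFree)) α-coprime pr p∣Tr p²∣N =
    squareFree⇒prime²∤ Δ-squareFree pr (prime∣Tr∧prime²∣N⇒prime²∣Δ (Δ²-Δ≡4c₀ fd) α-coprime pr p∣Tr p²∣N)
  prime∣Tr⇒prime²∤N {α} {p} fd@(_ , inj₂ (m , Δ≡4m , m%4≡2∨3 , m-squareFree)) α-coprime pr p∣Tr p²∣N
    with p ℕ.≟ 2
  ... | no p≢2 = squareFree⇒prime²∤ m-squareFree pr (prime^∣i*j⇒prime^∣j 2 pr (prime≢2⇒prime∤4 pr p≢2)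
                   (subst (_ ∣_) Δ≡4m (prime∣Tr∧prime²∣N⇒prime²∣Δ (Δ²-Δ≡4c₀ fd) α-coprime pr p∣Tr p²∣N)))
  ... | yes refl = 4∤x²-my² {m = m} {x = re α + + 2 * m * im α} m%4≡2∨3
                     (prime∣N⇒prime∤im α-coprime pr (∣-trans (∣m⇒∣m*n (+ 2) ∣-refl) p²∣N))
                     (subst (+ 4 ∣_) (N≡[x+2my]²-my² (Δ²-Δ≡4c₀ fd) Δ≡4m (re α) (im α)) p²∣N)

  -- If N α = 0, every p² divides N α, so no prime divides Tr α and Δ·(im α)² = Tr α² = 1.
  coprimeCoordinates⇒N≢0 : FundamentalDiscriminant Δ → CoprimeCoordinates α → N α ≢ + 0
  coprimeCoordinates⇒N≢0 {α} fd α-coprime N≡0 = proj₁ fd (i*[j*j]≡1⇒i≡1 Δ (im α) Δy²≡1)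
    where
    ∣Tr∣≡1 : abs (Tr α) ≡ 1
    ∣Tr∣≡1 = noPrimeDivisor⇒∣i∣≡1 λ pr p∣Tr →
      prime∣Tr⇒prime²∤N fd α-coprime pr p∣Tr (subst (_ ∣_) (sym N≡0) (divides (+ 0) refl))
    Δy²≡1 : Δ * (im α * im α) ≡ + 1
    Δy²≡1 = begin
      Δ * (im α * im α)                   ≡⟨ +-identityʳ _ ⟨
      Δ * (im α * im α) + + 4 * + 0       ≡⟨ cong (λ n → Δ * (im α * im α) + + 4 * n) N≡0 ⟨
      Δ * (im α * im α) + + 4 * N α       ≡⟨ Tr*Tr (Δ²-Δ≡4c₀ fd) α ⟨
      Tr α * Tr α                         ≡⟨ i*i≡+∣i∣*∣i∣ (Tr α) ⟩
      + (abs (Tr α) ℕ.* abs (Tr α))       ≡⟨ cong (λ t → + (t ℕ.* t)) ∣Tr∣≡1 ⟩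
      + 1                                 ∎
      where open ≡-Reasoning

  coprimeCoordinates⇒primitive : FundamentalDiscriminant Δ → CoprimeCoordinates α → Primitive α
  coprimeCoordinates⇒primitive fd α-coprime =
    N≢0⇒nonzero (coprimeCoordinates⇒N≢0 fd α-coprime) , λ p pr p∣α → α-coprime pr (ι∣𝒪⇒∣ℤ p∣α)

  signedConjugate : ∀ β → CoprimeCoordinates β →
    ∃[ ε ] CoprimeCoordinates ε × N ε ≡ N β × ε · β ≡ ι (+ abs (N β))
  signedConjugate β β-coprime with N β in Nβ≡
  ... | + k = conj β , coprimeCoordinates-conj β-coprime , trans (N-conj β) Nβ≡ ,
              trans (·-comm (conj β) β) (trans (·-conj β) (cong ι Nβ≡))
  ... | -[1+ k ] = ι (- + 1) · conj β , coprimeCoordinates-neg (coprimeCoordinates-conj β-coprime) ,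
                   trans (N-ι· (- + 1) (conj β)) (trans (*-identityˡ (N (conj β))) (trans (N-conj β) Nβ≡)) ,
                   (begin
                     ι (- + 1) · conj β · β   ≡⟨ ·-assoc (ι (- + 1)) (conj β) β ⟩
                     ι (- + 1) · (conj β · β) ≡⟨ cong (ι (- + 1) ·_) (trans (·-comm (conj β) β) (·-conj β)) ⟩
                     ι (- + 1) · ι (N β)      ≡⟨ ι·ι (- + 1) (N β) ⟩
                     ι (- + 1 * N β)          ≡⟨ cong ι (trans (-1*i≡-i (N β)) (cong -_ Nβ≡)) ⟩
                     ι (+ suc k)              ∎)
    where open ≡-Reasoning

  nonzero-ι·⁻¹ : ∀ k → Nonzero (ι k · δ) → Nonzero δ
  nonzero-ι·⁻¹ k kδ≢0 δ≡0 = kδ≢0 (trans (cong (ι k ·_) δ≡0) (trans (ι·ι k (+ 0)) (cong ι (*-zeroʳ k))))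

  module PowerClasses (n : ℕ) where

    [1+_]ⁿ : ℕ → ℤ
    [1+ a ]ⁿ = (+ suc a) ^ n

    ι[1+a]ⁿ·ι[1+b]ⁿ· : ∀ a b α → ι [1+ a ]ⁿ · (ι [1+ b ]ⁿ · α) ≡ ι [1+ ℕ.pred (suc a ℕ.* suc b) ]ⁿ · α
    ι[1+a]ⁿ·ι[1+b]ⁿ· a b α = trans (ι-* [1+ a ]ⁿ [1+ b ]ⁿ α)
      (cong (λ k → ι k · α) (sym (trans (cong (_^ n) (pos-* (suc a) (suc b)))
                                        (^-distrib-* (+ suc a) (+ suc b) n))))

    ι[1+0]ⁿ· : ∀ α → ι [1+ 0 ]ⁿ · α ≡ α
    ι[1+0]ⁿ· α = trans (cong (λ k → ι k · α) (^-zeroˡ n)) (ι1· α)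

    +∣i∣ⁿ≡[1+k]ⁿ : ∀ i → i ≢ + 0 → ∃[ k ] + (abs i ℕ.^ n) ≡ [1+ k ]ⁿ
    +∣i∣ⁿ≡[1+k]ⁿ (+ zero)   i≢0 = ⊥-elim (i≢0 refl)
    +∣i∣ⁿ≡[1+k]ⁿ (+ suc k)  _   = k , pos-^ (suc k) n
    +∣i∣ⁿ≡[1+k]ⁿ -[1+ k ]   _   = k , pos-^ (suc k) n

    infix 4 _∼ⁿ_
    _∼ⁿ_ : 𝒪 → 𝒪 → Set
    _∼ⁿ_ = _∼_ n

    α∼ⁿι[1+a]ⁿ·α : ∀ a α → α ∼ⁿ ι [1+ a ]ⁿ · α
    α∼ⁿι[1+a]ⁿ·α a α = a , 0 , sym (ι[1+0]ⁿ· (ι [1+ a ]ⁿ · α))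

    ∼ⁿ-trans : α ∼ⁿ β → β ∼ⁿ γ → α ∼ⁿ γ
    ∼ⁿ-trans {α} {β} {γ} (a , b , aα≡bβ) (c , d , cβ≡dγ) = _ , _ , (begin
      ι [1+ _ ]ⁿ · α                      ≡⟨ ι[1+a]ⁿ·ι[1+b]ⁿ· c a α ⟨
      ι [1+ c ]ⁿ · (ι [1+ a ]ⁿ · α)       ≡⟨ cong (ι [1+ c ]ⁿ ·_) aα≡bβ ⟩
      ι [1+ c ]ⁿ · (ι [1+ b ]ⁿ · β)       ≡⟨ x∙yz≈y∙xz (ι [1+ c ]ⁿ) (ι [1+ b ]ⁿ) β ⟩
      ι [1+ b ]ⁿ · (ι [1+ c ]ⁿ · β)       ≡⟨ cong (ι [1+ b ]ⁿ ·_) cβ≡dγ ⟩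
      ι [1+ b ]ⁿ · (ι [1+ d ]ⁿ · γ)       ≡⟨ ι[1+a]ⁿ·ι[1+b]ⁿ· b d γ ⟩
      ι [1+ _ ]ⁿ · γ                      ∎)
      where open ≡-Reasoning

    ∼ⁿ-· : ∀ {α′ β′} → α ∼ⁿ α′ → β ∼ⁿ β′ → α · β ∼ⁿ α′ · β′
    ∼ⁿ-· {α} {β} {α′} {β′} (a , b , aα≡bα′) (c , d , cβ≡dβ′) = _ , _ , (begin
      ι [1+ _ ]ⁿ · (α · β)                    ≡⟨ ι[1+a]ⁿ·ι[1+b]ⁿ· a c (α · β) ⟨
      ι [1+ a ]ⁿ · (ι [1+ c ]ⁿ · (α · β))     ≡⟨ scalars-interchange [1+ a ]ⁿ [1+ c ]ⁿ α β ⟩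
      (ι [1+ a ]ⁿ · α) · (ι [1+ c ]ⁿ · β)     ≡⟨ cong₂ _·_ aα≡bα′ cβ≡dβ′ ⟩
      (ι [1+ b ]ⁿ · α′) · (ι [1+ d ]ⁿ · β′)   ≡⟨ scalars-interchange [1+ b ]ⁿ [1+ d ]ⁿ α′ β′ ⟨
      ι [1+ b ]ⁿ · (ι [1+ d ]ⁿ · (α′ · β′))   ≡⟨ ι[1+a]ⁿ·ι[1+b]ⁿ· b d (α′ · β′) ⟩
      ι [1+ _ ]ⁿ · (α′ · β′)                  ∎)
      where
      open ≡-Reasoning
      scalars-interchange : ∀ k l α β → ι k · (ι l · (α · β)) ≡ (ι k · α) · (ι l · β)
      scalars-interchange k l α β = trans (cong (ι k ·_) (x∙yz≈y∙xz (ι l) α β)) (sym (·-assoc (ι k) α (ι l · β)))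

    ∼ⁿ-inverse : ∀ {m k} → α ∼ⁿ β → γ · α ≡ ι [1+ m ]ⁿ → ε · β ≡ ι [1+ k ]ⁿ → γ ∼ⁿ ε
    ∼ⁿ-inverse {α} {β} {γ} {ε} {m} {k} (a , b , aα≡bβ) γα≡mⁿ εβ≡kⁿ = _ , _ , (begin
      ι [1+ _ ]ⁿ · γ                     ≡⟨ ι[1+a]ⁿ·ι[1+b]ⁿ· b k γ ⟨
      ι [1+ b ]ⁿ · (ι [1+ k ]ⁿ · γ)      ≡⟨ cong (λ z → ι [1+ b ]ⁿ · (z · γ)) εβ≡kⁿ ⟨
      ι [1+ b ]ⁿ · ((ε · β) · γ)         ≡⟨ cong (ι [1+ b ]ⁿ ·_) (x∙yz≈zx∙y β γ ε) ⟨
      ι [1+ b ]ⁿ · (β · (γ · ε))         ≡⟨ ·-assoc (ι [1+ b ]ⁿ) β (γ · ε) ⟨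
      (ι [1+ b ]ⁿ · β) · (γ · ε)         ≡⟨ cong (_· (γ · ε)) aα≡bβ ⟨
      (ι [1+ a ]ⁿ · α) · (γ · ε)         ≡⟨ ·-assoc (ι [1+ a ]ⁿ) α (γ · ε) ⟩
      ι [1+ a ]ⁿ · (α · (γ · ε))         ≡⟨ cong (ι [1+ a ]ⁿ ·_) (x∙yz≈yx∙z α γ ε) ⟩
      ι [1+ a ]ⁿ · ((γ · α) · ε)         ≡⟨ cong (λ z → ι [1+ a ]ⁿ · (z · ε)) γα≡mⁿ ⟩
      ι [1+ a ]ⁿ · (ι [1+ m ]ⁿ · ε)      ≡⟨ ι[1+a]ⁿ·ι[1+b]ⁿ· a m ε ⟩
      ι [1+ _ ]ⁿ · ε                     ∎)
      where open ≡-Reasoning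

    ∼ⁿ-N≢0 : α ∼ⁿ β → N α ≢ + 0 → N β ≢ + 0
    ∼ⁿ-N≢0 {α} {β} (a , b , aα≡bβ) Nα≢0 Nβ≡0 = Nα≢0 (*-cancelˡ-≡ (aⁿ * aⁿ) (N α) (+ 0) {{a²ⁿ≢0}} (begin
      aⁿ * aⁿ * N α        ≡⟨ N-ι· aⁿ α ⟨
      N (ι aⁿ · α)         ≡⟨ cong N aα≡bβ ⟩
      N (ι bⁿ · β)         ≡⟨ N-ι· bⁿ β ⟩
      bⁿ * bⁿ * N β        ≡⟨ cong (bⁿ * bⁿ *_) Nβ≡0 ⟩
      bⁿ * bⁿ * + 0        ≡⟨ *-zeroʳ (bⁿ * bⁿ) ⟩
      + 0                  ≡⟨ *-zeroʳ (aⁿ * aⁿ) ⟨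
      aⁿ * aⁿ * + 0        ∎))
      where
      open ≡-Reasoning
      aⁿ bⁿ : ℤ
      aⁿ = [1+ a ]ⁿ
      bⁿ = [1+ b ]ⁿ
      a²ⁿ≢0 : ℤ.NonZero (aⁿ * aⁿ)
      a²ⁿ≢0 = i*j≢0 aⁿ aⁿ {{pos^-nonZero (suc a) n}} {{pos^-nonZero (suc a) n}}

  module PowerContent (n : ℕ) .{{_ : ℕ.NonZero n}} where
    open PowerClasses n

    -- Every prime occurs in gcd (re δ) (im δ) with multiplicity divisible by n.
    NthPowerContent : 𝒪 → Set
    NthPowerContent δ = ∀ {p} → Prime p → ∀ q → (+ p) ^ suc (q ℕ.* n) ∣ℤ δ → (+ p) ^ (suc q ℕ.* n) ∣ℤ δ

    prime∤prime^ : Prime p → ∀ {r} → Prime r → r ≢ p → ¬ (+ r ∣ (+ p) ^ n)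
    prime∤prime^ pr prr r≢p r∣pⁿ =
      [ prime≢1 prr , r≢p ]′ (prime⇒irreducible pr (∣⇒∣ᵤ (prime∣^⇒prime∣ n prr r∣pⁿ)))

    nthPowerContent-cancel : Prime p → NthPowerContent (ι ((+ p) ^ n) · δ) → NthPowerContent δ
    nthPowerContent-cancel {p} {δ} pr content {r} prr q r^[1+qn]∣δ with r ℕ.≟ p
    ... | yes refl = *-cancelˡ-∣ℤ pⁿ δ {{prime^-nonZero pr n}}
          (subst (_∣ℤ ι pⁿ · δ) (^-distribˡ-+-* (+ p) n (suc q ℕ.* n))
            (content pr (suc q) (subst (_∣ℤ ι pⁿ · δ) exponent (*-monoˡ-∣ℤ pⁿ δ r^[1+qn]∣δ))))
      where
      pⁿ : ℤ
      pⁿ = (+ p) ^ n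
      exponent : pⁿ * (+ p) ^ suc (q ℕ.* n) ≡ (+ p) ^ suc (suc q ℕ.* n)
      exponent = trans (sym (^-distribˡ-+-* (+ p) n (suc (q ℕ.* n)))) (cong ((+ p) ^_) (ℕP.+-suc n (q ℕ.* n)))
    ... | no r≢p = prime^∣ℤι·⇒prime^∣ℤ (suc q ℕ.* n) prr (prime∤prime^ pr prr r≢p)
                     (content prr q (∣ℤ-·ʳ (ι ((+ p) ^ n)) r^[1+qn]∣δ))

    nthPowerNorm-cancel : Prime p → N (ι ((+ p) ^ n) · δ) ≡ D ^ n → ∃[ D′ ] N δ ≡ D′ ^ n
    nthPowerNorm-cancel {p} {δ} {D} pr N≡Dⁿ = D′ , *-cancelˡ-≡ (pⁿ * pⁿ) (N δ) (D′ ^ n) {{pⁿ*pⁿ≢0}} (begin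
      pⁿ * pⁿ * N δ                ≡⟨ N-ι· pⁿ δ ⟨
      N (ι pⁿ · δ)                 ≡⟨ N≡Dⁿ ⟩
      D ^ n                        ≡⟨ cong (_^ n) D≡D′p² ⟩
      (D′ * (+ p) ^ 2) ^ n         ≡⟨ ^-distrib-* D′ ((+ p) ^ 2) n ⟩
      D′ ^ n * ((+ p) ^ 2) ^ n     ≡⟨ cong (λ p² → D′ ^ n * p² ^ n) (i^2≡i*i (+ p)) ⟩
      D′ ^ n * (+ p * + p) ^ n     ≡⟨ cong (D′ ^ n *_) (^-distrib-* (+ p) (+ p) n) ⟩
      D′ ^ n * (pⁿ * pⁿ)           ≡⟨ *-comm (D′ ^ n) _ ⟩
      pⁿ * pⁿ * D′ ^ n             ∎)
      where
      open ≡-Reasoning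
      pⁿ : ℤ
      pⁿ = (+ p) ^ n
      pⁿ*pⁿ≢0 : ℤ.NonZero (pⁿ * pⁿ)
      pⁿ*pⁿ≢0 = i*j≢0 pⁿ pⁿ {{prime^-nonZero pr n}} {{prime^-nonZero pr n}}
      p^[1+n]∣Dⁿ : (+ p) ^ suc (1 ℕ.* n) ∣ D ^ n
      p^[1+n]∣Dⁿ = ∣-trans (^-monoʳ-∣ (+ p) (ℕP.+-monoʳ-< n (ℕ.>-nonZero⁻¹ n)))
        (divides (N δ) (begin
          D ^ n                    ≡⟨ N≡Dⁿ ⟨
          N (ι pⁿ · δ)             ≡⟨ N-ι· pⁿ δ ⟩
          pⁿ * pⁿ * N δ            ≡⟨ *-comm _ (N δ) ⟩
          N δ * (pⁿ * pⁿ)          ≡⟨ cong (N δ *_) (^-distribˡ-+-* (+ p) n n) ⟨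
          N δ * (+ p) ^ (n ℕ.+ n)  ∎))
      D′ : ℤ
      D′ = quotient (prime^[1+qn]∣iⁿ⇒prime^[1+q]∣i n 1 pr p^[1+n]∣Dⁿ)
      D≡D′p² : D ≡ D′ * (+ p) ^ 2
      D≡D′p² = _∣_.equality (prime^[1+qn]∣iⁿ⇒prime^[1+q]∣i n 1 pr p^[1+n]∣Dⁿ)

    NthPowerTimesPrimitive : 𝒪 → Set
    NthPowerTimesPrimitive δ = ∃[ k ] ∃[ γ ] δ ≡ ι [1+ k ]ⁿ · γ × Primitive γ × ∃[ C ] N γ ≡ C ^ n

    ι·-nthPowerTimesPrimitive : Prime p → NthPowerTimesPrimitive δ → NthPowerTimesPrimitive (ι ((+ p) ^ n) · δ)
    ι·-nthPowerTimesPrimitive {suc p} {δ} _ (k , γ , δ≡kⁿγ , γ-primitive , Nγ≡Cⁿ) =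
      _ , γ , trans (cong (ι [1+ p ]ⁿ ·_) δ≡kⁿγ) (ι[1+a]ⁿ·ι[1+b]ⁿ· p k γ) , γ-primitive , Nγ≡Cⁿ

    size-ι·-< : Prime p → Nonzero δ → size δ ℕ.< size (ι ((+ p) ^ n) · δ)
    size-ι·-< {p} {δ} pr δ≢0 = subst (size δ ℕ.<_) (sym (trans (size-ι· ((+ p) ^ n) δ) (ℕP.*-comm _ (size δ))))
      (ℕP.m<m*n (size δ) (abs ((+ p) ^ n)) {{ℕ.≢-nonZero (λ size≡0 → δ≢0 (size≡0⇒≡0 size≡0))}} 1<∣pⁿ∣)
      where
      1<∣pⁿ∣ : 1 ℕ.< abs ((+ p) ^ n)
      1<∣pⁿ∣ = subst₂ ℕ._<_ (ℕP.^-zeroˡ n) (sym (abs-^ (+ p) n))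
        (ℕP.^-monoˡ-< n (ℕ.nonTrivial⇒n>1 p {{prime⇒nonTrivial pr}}))

    nthPowerContent⇒nthPowerTimesPrimitive : ∀ δ → Acc ℕ._<_ (size δ) → Nonzero δ → NthPowerContent δ →
                                             N δ ≡ D ^ n → NthPowerTimesPrimitive δ
    nthPowerContent⇒nthPowerTimesPrimitive {D} δ (acc smaller) δ≢0 content N≡Dⁿ with primitive⊎prime∣ℤ δ≢0
    ... | inj₁ δ-primitive = 0 , δ , sym (ι[1+0]ⁿ· δ) , δ-primitive , D , N≡Dⁿ
    ... | inj₂ (p , pr , p∣δ) = subst NthPowerTimesPrimitive (sym δ≡pⁿδ′)
            (ι·-nthPowerTimesPrimitive pr (nthPowerContent⇒nthPowerTimesPrimitive δ′ (smaller size-decreases) δ′≢0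
              (nthPowerContent-cancel pr (subst NthPowerContent δ≡pⁿδ′ content))
              (proj₂ (nthPowerNorm-cancel pr (trans (cong N (sym δ≡pⁿδ′)) N≡Dⁿ)))))
      where
      pⁿ∣δ : (+ p) ^ n ∣ℤ δ
      pⁿ∣δ = subst (λ e → (+ p) ^ e ∣ℤ δ) (ℕP.*-identityˡ n)
               (content pr 0 (∣-∣ℤ-trans (∣-reflexive (^-identityʳ (+ p))) p∣δ))
      δ′ : 𝒪
      δ′ = proj₁ (∣ℤ⇒ι∣𝒪 pⁿ∣δ)
      δ≡pⁿδ′ : δ ≡ ι ((+ p) ^ n) · δ′
      δ≡pⁿδ′ = proj₂ (∣ℤ⇒ι∣𝒪 pⁿ∣δ)
      δ′≢0 : Nonzero δ′
      δ′≢0 = nonzero-ι·⁻¹ ((+ p) ^ n) (subst Nonzero δ≡pⁿδ′ δ≢0)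
      size-decreases : size δ′ ℕ.< size δ
      size-decreases = subst (size δ′ ℕ.<_) (cong size (sym δ≡pⁿδ′)) (size-ι·-< pr δ′≢0)

    ∼ⁿ-nthPowerTimesPrimitive⇒InΠ : δ ∼ⁿ α → NthPowerTimesPrimitive δ → InΠ n α
    ∼ⁿ-nthPowerTimesPrimitive⇒InΠ δ∼α (k , γ , δ≡kⁿγ , γ-primitive , Nγ≡Cⁿ) =
      γ , ∼ⁿ-trans (subst (γ ∼ⁿ_) (sym δ≡kⁿγ) (α∼ⁿι[1+a]ⁿ·α k γ)) δ∼α , γ-primitive , Nγ≡Cⁿ

  module _ (fd : FundamentalDiscriminant Δ) (n : ℕ) (n≥2 : n ≥ 2) where
    private instance
      n-nonZero : ℕ.NonZero n
      n-nonZero = ℕ.>-nonZero (ℕP.≤-trans (s≤s z≤n) n≥2)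
    open PowerClasses n
    open PowerContent n

    ·-nthPowerContent : CoprimeCoordinates α → CoprimeCoordinates β → N α ≡ A ^ n → N β ≡ B ^ n →
                        NthPowerContent (α · β)
    ·-nthPowerContent {α} {β} {A} {B} α-coprime β-coprime Nα≡Aⁿ Nβ≡Bⁿ {p} pr q p^[1+qn]∣αβ =
      prime^∣i*j⇒prime^∣j M pr p∤Tr[αβ′] (subst (_ ∣_) (sym (Tr-·-conj*re-· α β)) (p^M∣Nα*u+Nβ*v _ _)) ,
      prime^∣i*j⇒prime^∣j M pr p∤Tr[αβ′] (subst (_ ∣_) (sym (Tr-·-conj*im-· α β)) (p^M∣Nα*u+Nβ*v _ _))
      where
      M : ℕ
      M = suc q ℕ.* n
      p^M∣Nα : (+ p) ^ M ∣ N α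
      p^M∣Nα = subst ((+ p) ^ M ∣_) (sym Nα≡Aⁿ) (prime^[1+qn]∣iⁿ⇒prime^[[1+q]n]∣iⁿ n q pr
        (subst (_ ∣_) Nα≡Aⁿ (prime^∣ℤ·⇒prime^∣N (suc (q ℕ.* n)) α β-coprime pr p^[1+qn]∣αβ)))
      p^M∣Nβ : (+ p) ^ M ∣ N β
      p^M∣Nβ = subst ((+ p) ^ M ∣_) (sym Nβ≡Bⁿ) (prime^[1+qn]∣iⁿ⇒prime^[[1+q]n]∣iⁿ n q pr
        (subst (_ ∣_) Nβ≡Bⁿ (prime^∣ℤ·⇒prime^∣N (suc (q ℕ.* n)) β α-coprime pr
          (subst (_ ∣ℤ_) (·-comm α β) p^[1+qn]∣αβ))))
      p²∣p^M : (+ p) ^ 2 ∣ (+ p) ^ M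
      p²∣p^M = ^-monoʳ-∣ (+ p) (ℕP.≤-trans n≥2 (ℕP.m≤m+n n (q ℕ.* n)))
      p∤Tr[αβ′] : ¬ (+ p ∣ Tr (α · conj β))
      p∤Tr[αβ′] p∣Tr[αβ′] =
        [ (λ p∣Trα → prime∣Tr⇒prime²∤N fd α-coprime pr p∣Trα (∣-trans p²∣p^M p^M∣Nα))
        , (λ p∣Trβ → prime∣Tr⇒prime²∤N fd β-coprime pr p∣Trβ (∣-trans p²∣p^M p^M∣Nβ)) ]′
        (euclidsLemmaℤ (Tr α) (Tr β) pr (subst (_ ∣_) (Tr-·-conj α β) (∣m∣n⇒∣m+n p∣Tr[αβ] p∣Tr[αβ′])))
        where
        p∣Tr[αβ] : + p ∣ Tr (α · β)
        p∣Tr[αβ] = ∣ℤ⇒∣Tr (∣-∣ℤ-trans (∣m⇒∣m*n _ ∣-refl) p^[1+qn]∣αβ)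
      p^M∣Nα*u+Nβ*v : ∀ u v → (+ p) ^ M ∣ N α * u + N β * v
      p^M∣Nα*u+Nβ*v u v = ∣m∣n⇒∣m+n (∣m⇒∣m*n u p^M∣Nα) (∣m⇒∣m*n v p^M∣Nβ)

    one∈Π : InΠ n one
    one∈Π = one , (0 , 0 , refl) , coprimeCoordinates⇒primitive fd one-coprime ,
            + 1 , trans (N-ι (+ 1)) (sym (^-zeroˡ n))
      where
      one-coprime : CoprimeCoordinates one
      one-coprime pr (p∣1 , _) = prime≢1 pr (ℕD.∣1⇒≡1 (∣⇒∣ᵤ p∣1))

    ·-closed : ∀ α β → Nonzero α → Nonzero β → InΠ n α → InΠ n β → InΠ n (α · β)
    ·-closed α β _ _ (α₀ , α₀∼α , α₀-primitive , A , Nα₀≡Aⁿ) (β₀ , β₀∼β , β₀-primitive , B , Nβ₀≡Bⁿ) =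
      ∼ⁿ-nthPowerTimesPrimitive⇒InΠ (∼ⁿ-· α₀∼α β₀∼β)
        (nthPowerContent⇒nthPowerTimesPrimitive (α₀ · β₀) (<-wellFounded _) α₀β₀≢0
          (·-nthPowerContent α₀-coprime β₀-coprime Nα₀≡Aⁿ Nβ₀≡Bⁿ) Nα₀β₀≡[AB]ⁿ)
      where
      α₀-coprime : CoprimeCoordinates α₀
      α₀-coprime = primitive⇒coprimeCoordinates α₀-primitive
      β₀-coprime : CoprimeCoordinates β₀
      β₀-coprime = primitive⇒coprimeCoordinates β₀-primitive
      α₀β₀≢0 : Nonzero (α₀ · β₀)
      α₀β₀≢0 = N≢0⇒nonzero λ Nα₀β₀≡0 →
        [ coprimeCoordinates⇒N≢0 fd α₀-coprime , coprimeCoordinates⇒N≢0 fd β₀-coprime ]′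
        (i*j≡0⇒i≡0∨j≡0 (N α₀) (trans (sym (N-· α₀ β₀)) Nα₀β₀≡0))
      Nα₀β₀≡[AB]ⁿ : N (α₀ · β₀) ≡ (A * B) ^ n
      Nα₀β₀≡[AB]ⁿ = trans (N-· α₀ β₀) (trans (cong₂ _*_ Nα₀≡Aⁿ Nβ₀≡Bⁿ) (sym (^-distrib-* A B n)))

    inverse-closed : ∀ α γ → Nonzero α → InΠ n α → γ · α ≡ ι (+ (abs (N α) ℕ.^ n)) → InΠ n γ
    inverse-closed α γ _ (β , β∼α , β-primitive , B , Nβ≡Bⁿ) γα≡∣Nα∣ⁿ =
      let ε , ε-coprime , Nε≡Nβ , εβ≡∣Nβ∣ = signedConjugate β β-coprime
          m , ∣Nα∣ⁿ≡mⁿ = +∣i∣ⁿ≡[1+k]ⁿ (N α) (∼ⁿ-N≢0 β∼α Nβ≢0)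
          k , ∣B∣ⁿ≡kⁿ = +∣i∣ⁿ≡[1+k]ⁿ B B≢0
          ∣Nβ∣≡kⁿ : + abs (N β) ≡ [1+ k ]ⁿ
          ∣Nβ∣≡kⁿ = trans (cong (λ z → + abs z) Nβ≡Bⁿ) (trans (cong +_ (abs-^ B n)) ∣B∣ⁿ≡kⁿ)
      in ε , ∼ⁿ-inverse β∼α (trans εβ≡∣Nβ∣ (cong ι ∣Nβ∣≡kⁿ)) (trans γα≡∣Nα∣ⁿ (cong ι ∣Nα∣ⁿ≡mⁿ)) ,
         coprimeCoordinates⇒primitive fd ε-coprime , B , trans Nε≡Nβ Nβ≡Bⁿ
      where
      β-coprime : CoprimeCoordinates β
      β-coprime = primitive⇒coprimeCoordinates β-primitive
      Nβ≢0 : N β ≢ + 0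
      Nβ≢0 = coprimeCoordinates⇒N≢0 fd β-coprime
      B≢0 : B ≢ + 0
      B≢0 B≡0 = Nβ≢0 (trans Nβ≡Bⁿ (trans (cong (_^ n) B≡0) (0^n≡0 n)))

    Π-isSubgroup : IsSubgroupΠ n
    Π-isSubgroup = one∈Π , ·-closed , inverse-closed

proposition1 : (Δ : ℤ) → FundamentalDiscriminant Δ → (n : ℕ) → n ≥ 2
    → QuadraticOrder.IsSubgroupΠ Δ n
proposition1 Δ fd n n≥2 = Π-isSubgroup Δ fd n n≥2
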